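{- Let $r,s\geq 3$ be positive integers such that $s$ divides $r$. Then every (finite, simple) $r$-regular bipartite graph $G$ is $S$-decomposable for every double-star $S$ of size $s$.
   Context: A double-star is a tree with exactly two non-pendant vertices (a pendant vertex being a vertex of degree $1$). For positive integers $k_1,k_2$, $S_{k_1,k_2}$ denotes the double-star with degree sequence $(k_1+1,k_2+1,1,\ldots,1)$; it has $k_1+k_2+1$ edges. The size of a graph is its number of edges. For a graph $H$, a graph $G$ is $H$-decomposable (or $H$ decomposes $G$, or $G$ can be decomposed into $H$) if $E(G)$ can be partitioned into subsets each of which induces (as an edge set) a subgraph isomorphic to $H$. -}

module Defs where

open import Data.Nat using (ℕ; zero; suc; _+_)
open import Data.Fin using (Fin; _<_; _≤?_; toℕ) renaming (zero to fz; suc to fs)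
open import Data.Fin.Properties using (_≟_)
open import Data.Bool using (Bool; true; false; if_then_else_)
open import Data.Product using (_×_; _,_; proj₁; proj₂; Σ; ∃)
open import Data.Sum using (_⊎_)
open import Data.List using (List; []; _∷_; map; concatMap; length; filter; allFin; _++_)
open import Data.List.Relation.Unary.All using (All)
open import Data.List.Relation.Unary.Unique.Propositional using (Unique)
open import Data.List.Relation.Binary.Permutation.Propositional using (_↭_)
open import Relation.Binary.PropositionalEquality using (_≡_; _≢_)
open import Relation.Nullary using (Dec; yes; no; ¬_)
open import Relation.Nullary.Decidable using (_⊎-dec_)
open import Function.Definitions using (Injective)

-- An edge is a pair of vertices, stored in canonical form (u , v) with u < v.
Edge : ℕ → Set
Edge n = Fin n × Fin n

record SimpleGraph (n : ℕ) : Set where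
  field
    edges     : List (Edge n)
    canonical : All (λ e → proj₁ e < proj₂ e) edges
    simple    : Unique edges
open SimpleGraph public

incident? : ∀ {n} (v : Fin n) (e : Edge n) → Dec ((proj₁ e ≡ v) ⊎ (proj₂ e ≡ v))
incident? v e = (proj₁ e ≟ v) ⊎-dec (proj₂ e ≟ v)

degree : ∀ {n} → SimpleGraph n → Fin n → ℕ
degree G v = length (filter (incident? v) (edges G))

Regular : ∀ {n} → ℕ → SimpleGraph n → Set
Regular r G = ∀ v → degree G v ≡ r

Bipartite : ∀ {n} → SimpleGraph n → Set
Bipartite {n} G = Σ (Fin n → Bool) λ col →
  All (λ e → col (proj₁ e) ≢ col (proj₂ e)) (edges G)

norm : ∀ {n} → Edge n → Edge n
norm (u , v) with u ≤? v
... | yes _ = (u , v)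
... | no  _ = (v , u)

-- The double-star S_{k1,k2} on vertex set Fin (k1 + k2 + 2):
-- centre a = vertex 0, centre b = vertex 1, edge a b,
-- leaves 2 .. k1+1 attached to a, leaves k1+2 .. k1+k2+1 attached to b.
-- It has degree sequence (k1+1, k2+1, 1, ..., 1) and k1+k2+1 edges.
doubleStarEdges : (k₁ k₂ : ℕ) → List (Edge (suc (suc (k₁ + k₂))))
doubleStarEdges k₁ k₂ =
  (fz , fs fz)
  ∷ map (λ i → (fz , fs (fs (i Data.Fin.↑ˡ k₂)))) (allFin k₁)
  ++ map (λ j → (fs fz , fs (fs (k₁ Data.Fin.↑ʳ j)))) (allFin k₂)

record Embedding (k₁ k₂ n : ℕ) : Set where
  field
    f   : Fin (suc (suc (k₁ + k₂))) → Fin n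
    inj : Injective _≡_ _≡_ f
open Embedding public

copyEdges : ∀ {k₁ k₂ n} → Embedding k₁ k₂ n → List (Edge n)
copyEdges {k₁} {k₂} φ = map (λ e → norm (f φ (proj₁ e) , f φ (proj₂ e))) (doubleStarEdges k₁ k₂)

-- G is S_{k1,k2}-decomposable: E(G) is partitioned (as a multiset of edges,
-- hence exactly, since E(G) has no repetitions) into edge sets each inducing
-- a subgraph isomorphic to S_{k1,k2}.
DoubleStarDecomposable : ∀ {n} → ℕ → ℕ → SimpleGraph n → Set
DoubleStarDecomposable {n} k₁ k₂ G =
  Σ (List (Embedding k₁ k₂ n)) λ parts → concatMap copyEdges parts ↭ edges G

-- König's theorem colours the edges of an r-regular bipartite graph with r
-- colours, each colour class then being a perfect matching; edges are coloured
-- one at a time, a Kempe swap along an alternating path freeing a colour common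
-- to both ends of the new edge. With r = t s and s = k₁ + k₂ + 1, split the
-- colours into t blocks of s. In block j, each vertex a on one fixed side is a
-- centre of a double star whose other centre b is a's partner in the block's
-- first colour, whose leaves at a are a's partners in the next k₁ colours, and
-- whose leaves at b are b's partners in the last k₂ colours. An edge of colour
-- (j , i) with end a on the fixed side lies in exactly one of these stars: the
-- one of block j centred at a when i is the first or an a-leaf colour, and
-- otherwise the one centred at the partner, in colour (j , 0), of its other end.

module Submission where

open import Defs
open import Data.Nat using (ℕ; zero; suc; _+_; _*_; _∸_; _≤_; _<_; s≤s; z≤n)
open import Data.Nat.Divisibility using (_∣_; divides)
import Data.Nat.Properties as ℕ
open import Data.Bool using (Bool; true; false; not; if_then_else_)
open import Data.Bool.Properties using (not-involutive; not-injective; ¬-not; not-¬)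
  renaming (_≟_ to _≟ᵇ_)
open import Data.Fin as Fin using (Fin; toℕ; fromℕ<; _↑ˡ_; _↑ʳ_; splitAt; combine; remQuot)
  renaming (zero to fz; suc to fs)
open import Data.Fin.Properties
  using (_≟_; ≤-antisym; ≤-total; any?; pigeonhole; toℕ≤pred[n]; toℕ-fromℕ<; suc-injective;
         combine-injective; remQuot-combine; combine-remQuot; ↑ˡ-injective; ↑ʳ-injective;
         splitAt-↑ˡ; splitAt-↑ʳ; splitAt⁻¹-↑ˡ; splitAt⁻¹-↑ʳ)
open import Data.Product using (_×_; _,_; proj₁; proj₂; Σ; ∃; uncurry; swap)
open import Data.Sum using (_⊎_; inj₁; inj₂; [_,_]′)
open import Data.Empty using (⊥; ⊥-elim)
open import Data.Maybe using (Maybe; just; nothing; _>>=_)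
open import Data.Maybe.Properties as Maybe using (just-injective)
open import Data.List
  using (List; []; _∷_; map; concatMap; length; filter; allFin; _++_; lookup; cartesianProduct)
open import Data.List.Properties using (concatMap-map; filter-accept; filter-reject)
open import Data.List.Relation.Unary.All as All using (All; []; _∷_)
import Data.List.Relation.Unary.All.Properties as All
open import Data.List.Relation.Unary.Any as Any using (here; there; index)
import Data.List.Relation.Unary.Any.Properties as Any
open import Data.List.Relation.Unary.AllPairs using ([]; _∷_)
open import Data.List.Relation.Unary.Unique.Propositional using (Unique)
import Data.List.Relation.Unary.Unique.Propositional.Properties as Unique
open import Data.List.Membership.Propositional using (_∈_; find)
open import Data.List.Membership.Propositional.Properties
open import Data.List.Membership.Propositional.Properties.WithK using (unique∧set⇒bag)
open import Data.List.Relation.Binary.BagAndSetEquality using (∼bag⇒↭)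
open import Data.List.Relation.Binary.Permutation.Propositional using (_↭_)
open import Function using (_∘_; const; mk⇔; Injective)
open import Relation.Binary.PropositionalEquality
open ≡-Reasoning
open import Relation.Nullary using (¬_; yes; no; does)
open import Relation.Nullary.Decidable using (dec-true; _⊎-dec_)

module _ {A : Set} where

  Unique-lookup-injective : ∀ {xs : List A} → Unique xs →
                            ∀ {i j} → lookup xs i ≡ lookup xs j → i ≡ j
  Unique-lookup-injective (_  ∷ _) {fz}   {fz}   _ = refl
  Unique-lookup-injective (x∉ ∷ _) {fz}   {fs j} e = ⊥-elim (All.lookup x∉ (∈-lookup j) e)
  Unique-lookup-injective (x∉ ∷ _) {fs i} {fz}   e = ⊥-elim (All.lookup x∉ (∈-lookup i) (sym e))
  Unique-lookup-injective (_  ∷ u) {fs i} {fs j} e = cong fs (Unique-lookup-injective u e)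

  Unique-map⁺ : ∀ {B : Set} (g : A → B) {xs : List A} → Unique xs →
                (∀ {x y} → x ∈ xs → y ∈ xs → g x ≡ g y → x ≡ y) → Unique (map g xs)
  Unique-map⁺ g {[]}     _        _   = []
  Unique-map⁺ g {x ∷ xs} (x∉ ∷ u) inj =
    All.tabulate distinct ∷ Unique-map⁺ g u (λ p q → inj (there p) (there q))
    where
    distinct : ∀ {y} → y ∈ map g xs → g x ≢ y
    distinct y∈ e with ∈-map⁻ g y∈
    ... | z , z∈ , refl = All.lookup x∉ z∈ (inj (here refl) (there z∈) e)

  Unique-concatMap⁺ : ∀ {P : Set} (key : A → Maybe P) (h : P → List A) (ps : List P) →
                      Unique ps → (∀ p → Unique (h p)) →
                      (∀ {p} → p ∈ ps → All (λ x → key x ≡ just p) (h p)) →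
                      Unique (concatMap h ps)
  Unique-concatMap⁺ key h []       _          _  _   = []
  Unique-concatMap⁺ key h (p ∷ ps) (p∉ ∷ ups) uh keyed =
    Unique.++⁺ (uh p) (Unique-concatMap⁺ key h ps ups uh (keyed ∘ there)) disjoint
    where
    disjoint : ∀ {x} → ¬ (x ∈ h p × x ∈ concatMap h ps)
    disjoint (x∈ , x∈′) with find (∈-concatMap⁻ h {xs = ps} x∈′)
    ... | q , q∈ , x∈q = All.lookup p∉ q∈ (just-injective
      (trans (sym (All.lookup (keyed (here refl)) x∈)) (All.lookup (keyed (there q∈)) x∈q)))

-- Edges and double stars

Canonical : ∀ {n} → Edge n → Set
Canonical e = proj₁ e Fin.< proj₂ e

norm-cases : ∀ {n} (x y : Fin n) → norm (x , y) ≡ (x , y) ⊎ norm (x , y) ≡ (y , x)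
norm-cases x y with x Fin.≤? y
... | yes _ = inj₁ refl
... | no  _ = inj₂ refl

norm-canonical : ∀ {n} {x y : Fin n} → x Fin.< y → norm (x , y) ≡ (x , y)
norm-canonical {x = x} {y} x<y with x Fin.≤? y
... | yes _   = refl
... | no  x≰y = ⊥-elim (x≰y (ℕ.<⇒≤ x<y))

norm-comm : ∀ {n} (x y : Fin n) → norm (x , y) ≡ norm (y , x)
norm-comm x y with x Fin.≤? y | y Fin.≤? x
... | yes x≤y | yes y≤x = cong₂ _,_ (≤-antisym x≤y y≤x) (≤-antisym y≤x x≤y)
... | yes _   | no  _   = refl
... | no  _   | yes _   = refl
... | no  x≰y | no  y≰x = ⊥-elim ([ x≰y , y≰x ]′ (≤-total x y))

norm-injective : ∀ {n} {x y x′ y′ : Fin n} → norm (x , y) ≡ norm (x′ , y′) →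
                 (x , y) ≡ (x′ , y′) ⊎ (x , y) ≡ (y′ , x′)
norm-injective {x = x} {y} {x′} {y′} e with norm-cases x y | norm-cases x′ y′
... | inj₁ a | inj₁ b = inj₁ (trans (sym a) (trans e b))
... | inj₁ a | inj₂ b = inj₂ (trans (sym a) (trans e b))
... | inj₂ a | inj₁ b = inj₂ (cong swap (trans (sym a) (trans e b)))
... | inj₂ a | inj₂ b = inj₁ (cong swap (trans (sym a) (trans e b)))

module DoubleStar (k₁ k₂ : ℕ) where

  V : ℕ
  V = suc (suc (k₁ + k₂))

  leftEdge : Fin k₁ → Edge V
  leftEdge i = (fz , fs (fs (i ↑ˡ k₂)))

  rightEdge : Fin k₂ → Edge V
  rightEdge i = (fs fz , fs (fs (k₁ ↑ʳ i)))

  data Shape : Edge V → Set where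
    centre : Shape (fz , fs fz)
    left   : ∀ i → Shape (leftEdge i)
    right  : ∀ i → Shape (rightEdge i)

  shape : ∀ {e} → e ∈ doubleStarEdges k₁ k₂ → Shape e
  shape (here refl) = centre
  shape (there e∈) with ∈-++⁻ (map leftEdge (allFin k₁)) e∈
  ... | inj₁ e∈ˡ with ∈-map⁻ leftEdge e∈ˡ
  ...   | i , _ , refl = left i
  shape (there e∈) | inj₂ e∈ʳ with ∈-map⁻ rightEdge e∈ʳ
  ...   | i , _ , refl = right i

  leftEdge∈ : ∀ i → leftEdge i ∈ doubleStarEdges k₁ k₂
  leftEdge∈ i = there (∈-++⁺ˡ (∈-map⁺ leftEdge (∈-allFin i)))

  rightEdge∈ : ∀ i → rightEdge i ∈ doubleStarEdges k₁ k₂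
  rightEdge∈ i = there (∈-++⁺ʳ (map leftEdge (allFin k₁)) (∈-map⁺ rightEdge (∈-allFin i)))

  doubleStar-canonical : ∀ {e} → e ∈ doubleStarEdges k₁ k₂ → Canonical e
  doubleStar-canonical e∈ with shape e∈
  ... | centre  = s≤s z≤n
  ... | left _  = s≤s z≤n
  ... | right _ = s≤s (s≤s z≤n)

  doubleStar-unique : Unique (doubleStarEdges k₁ k₂)
  doubleStar-unique =
    All.tabulate centre∉ ∷ Unique.++⁺ (Unique.map⁺ left-injective (Unique.allFin⁺ k₁))
                                       (Unique.map⁺ right-injective (Unique.allFin⁺ k₂)) left∉right
    where
    leaves : List (Edge V)
    leaves = map leftEdge (allFin k₁) ++ map rightEdge (allFin k₂)
    centre∉ : ∀ {e} → e ∈ leaves → (fz , fs fz) ≢ e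
    centre∉ e∈ with ∈-++⁻ (map leftEdge (allFin k₁)) e∈
    ... | inj₁ e∈ˡ with ∈-map⁻ leftEdge e∈ˡ
    ...   | _ , _ , refl = λ ()
    centre∉ e∈ | inj₂ e∈ʳ with ∈-map⁻ rightEdge e∈ʳ
    ...   | _ , _ , refl = λ ()
    left-injective : ∀ {i j} → leftEdge i ≡ leftEdge j → i ≡ j
    left-injective e = ↑ˡ-injective k₂ _ _ (suc-injective (suc-injective (cong proj₂ e)))
    right-injective : ∀ {i j} → rightEdge i ≡ rightEdge j → i ≡ j
    right-injective e = ↑ʳ-injective k₁ _ _ (suc-injective (suc-injective (cong proj₂ e)))
    left∉right : ∀ {e} → ¬ (e ∈ map leftEdge (allFin k₁) × e ∈ map rightEdge (allFin k₂))
    left∉right (e∈ˡ , e∈ʳ) with ∈-map⁻ leftEdge e∈ˡ | ∈-map⁻ rightEdge e∈ʳ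
    ... | _ , _ , refl | _ , _ , ()

copyEdges-unique : ∀ {k₁ k₂ n} (φ : Embedding k₁ k₂ n) → Unique (copyEdges φ)
copyEdges-unique {k₁} {k₂} φ = Unique-map⁺ image doubleStar-unique image-injective
  where
  open DoubleStar k₁ k₂
  image : Edge V → Edge _
  image (x , y) = norm (f φ x , f φ y)
  image-injective : ∀ {e e′} → e ∈ doubleStarEdges k₁ k₂ → e′ ∈ doubleStarEdges k₁ k₂ →
                    image e ≡ image e′ → e ≡ e′
  image-injective {x , y} {x′ , y′} e∈ e′∈ eq with norm-injective eq
  ... | inj₁ same    = cong₂ _,_ (inj φ (cong proj₁ same)) (inj φ (cong proj₂ same))
  ... | inj₂ swapped = ⊥-elim (ℕ.<-asym (doubleStar-canonical e∈)
      (subst₂ Fin._<_ (sym (inj φ (cong proj₂ swapped))) (sym (inj φ (cong proj₁ swapped)))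
                       (doubleStar-canonical e′∈)))

Joins : ∀ {n} → Edge n → Fin n → Fin n → Set
Joins e x y = e ≡ (x , y) ⊎ e ≡ (y , x)

Joins-injectiveʳ : ∀ {n} {e : Edge n} {x y y′} → x ≢ y → Joins e x y → Joins e x y′ → y ≡ y′
Joins-injectiveʳ _   (inj₁ refl) (inj₁ e) = cong proj₂ e
Joins-injectiveʳ _   (inj₂ refl) (inj₂ e) = cong proj₁ e
Joins-injectiveʳ x≢y (inj₁ refl) (inj₂ e) = ⊥-elim (x≢y (sym (cong proj₂ e)))
Joins-injectiveʳ x≢y (inj₂ refl) (inj₁ e) = ⊥-elim (x≢y (sym (cong proj₁ e)))

Joins-canonical : ∀ {n} {e e′ : Edge n} {x y} → Canonical e → Canonical e′ →
                  Joins e x y → Joins e′ x y → e ≡ e′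
Joins-canonical _ _  (inj₁ refl) (inj₁ refl) = refl
Joins-canonical _ _  (inj₂ refl) (inj₂ refl) = refl
Joins-canonical c c′ (inj₁ refl) (inj₂ refl) = ⊥-elim (ℕ.<-asym c c′)
Joins-canonical c c′ (inj₂ refl) (inj₁ refl) = ⊥-elim (ℕ.<-asym c c′)

degreeIn : ∀ {n} → List (Edge n) → Fin n → ℕ
degreeIn es x = length (filter (incident? x) es)

degreeIn-∷-≤ : ∀ {n} e (es : List (Edge n)) x → degreeIn es x ≤ degreeIn (e ∷ es) x
degreeIn-∷-≤ e es x with incident? x e
... | yes p rewrite filter-accept (incident? x) {xs = es} p = ℕ.n≤1+n _
... | no ¬p rewrite filter-reject (incident? x) {xs = es} ¬p = ℕ.≤-refl

degreeIn-∷-incident : ∀ {n} e (es : List (Edge n)) x → (proj₁ e ≡ x ⊎ proj₂ e ≡ x) →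
                      degreeIn (e ∷ es) x ≡ suc (degreeIn es x)
degreeIn-∷-incident e es x p = cong length (filter-accept (incident? x) p)

-- König's edge-colouring theorem

-- An R-edge-colouring is stored as R partial matchings: M c x is the partner
-- of x along the edge of colour c at x, if there is one.
module EdgeColouring {n : ℕ} (side : Fin n → Bool) (R : ℕ) where

  Matchings : Set
  Matchings = Fin R → Fin n → Maybe (Fin n)

  record Proper (M : Matchings) : Set where
    field
      symmetric     : ∀ {c x y} → M c x ≡ just y → M c y ≡ just x
      crossing      : ∀ {c x y} → M c x ≡ just y → side x ≢ side y
      colour-unique : ∀ {c c′ x y} → M c x ≡ just y → M c′ x ≡ just y → c ≡ c′
  open Proper

  Adjacent : List (Edge n) → Fin n → Fin n → Set
  Adjacent es x y = (x , y) ∈ es ⊎ (y , x) ∈ es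

  Sound : Matchings → List (Edge n) → Set
  Sound M es = ∀ {c x y} → M c x ≡ just y → Adjacent es x y

  Complete : Matchings → List (Edge n) → Set
  Complete M es = ∀ {x y} → (x , y) ∈ es → ∃ λ c → M c x ≡ just y

  record Colouring (es : List (Edge n)) : Set where
    field
      M        : Matchings
      proper   : Proper M
      sound    : Sound M es
      complete : Complete M es

  module KempeSwap {M : Matchings} (P : Proper M) (α β : Fin R) (K : Fin n → Bool)
    (closed : ∀ {c x y} → K x ≡ true → (c ≡ α ⊎ c ≡ β) → M c x ≡ just y → K y ≡ true) where

    swapColour : Fin R → Fin R
    swapColour c with c ≟ α
    ... | yes _ = β
    ... | no _ with c ≟ β
    ...   | yes _ = α
    ...   | no _  = c

    swapColour-involutive : ∀ c → swapColour (swapColour c) ≡ c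
    swapColour-involutive c with c ≟ α
    swapColour-involutive c | yes refl with β ≟ α
    ... | yes refl = refl
    ... | no _ with β ≟ β
    ...   | yes _   = refl
    ...   | no β≢β = ⊥-elim (β≢β refl)
    swapColour-involutive c | no c≢α with c ≟ β
    swapColour-involutive c | no c≢α | yes refl with α ≟ α
    ... | yes _   = refl
    ... | no α≢α = ⊥-elim (α≢α refl)
    swapColour-involutive c | no c≢α | no c≢β with c ≟ α
    ... | yes c≡α = ⊥-elim (c≢α c≡α)
    ... | no _ with c ≟ β
    ...   | yes c≡β = ⊥-elim (c≢β c≡β)
    ...   | no _    = refl

    swapColour-fixes : ∀ c → ¬ (c ≡ α ⊎ c ≡ β) → swapColour c ≡ c
    swapColour-fixes c c∉ with c ≟ α
    ... | yes c≡α = ⊥-elim (c∉ (inj₁ c≡α))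
    ... | no _ with c ≟ β
    ...   | yes c≡β = ⊥-elim (c∉ (inj₂ c≡β))
    ...   | no _    = refl

    swapColour-preserves : ∀ c → (c ≡ α ⊎ c ≡ β) → (swapColour c ≡ α ⊎ swapColour c ≡ β)
    swapColour-preserves c c∈ with c ≟ α
    ... | yes _ = inj₂ refl
    ... | no _ with c ≟ β
    ...   | yes _ = inj₁ refl
    ...   | no _  = c∈

    swapColour-α : swapColour α ≡ β
    swapColour-α with α ≟ α
    ... | yes _   = refl
    ... | no α≢α = ⊥-elim (α≢α refl)

    recolour : Fin n → Fin R → Fin R
    recolour x c = if K x then swapColour c else c

    recolour-involutive : ∀ x c → recolour x (recolour x c) ≡ c
    recolour-involutive x c with K x
    ... | true  = swapColour-involutive c
    ... | false = refl

    M′ : Matchings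
    M′ c x = M (recolour x c) x

    -- Closedness of K under α/β-edges is exactly what makes both ends of an edge agree.
    recolour-along : ∀ {c x y} → M (recolour x c) x ≡ just y → recolour y c ≡ recolour x c
    recolour-along {c} {x} {y} h with K x in Kx | K y in Ky
    ... | true  | true  = refl
    ... | false | false = refl
    ... | true  | false with (c ≟ α) ⊎-dec (c ≟ β)
    ...   | yes c∈ with () ← trans (sym (closed Kx (swapColour-preserves c c∈) h)) Ky
    ...   | no c∉  = sym (swapColour-fixes c c∉)
    recolour-along {c} {x} {y} h | false | true with (c ≟ α) ⊎-dec (c ≟ β)
    ...   | yes c∈ with () ← trans (sym (closed Ky c∈ (symmetric P h))) Kx
    ...   | no c∉  = swapColour-fixes c c∉

    proper′ : Proper M′
    proper′ = record
      { symmetric     = λ {c} {x} {y} h →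
          subst (λ d → M d y ≡ just x) (sym (recolour-along h)) (symmetric P h)
      ; crossing      = crossing P
      ; colour-unique = λ {c} {c′} {x} h h′ →
          trans (sym (recolour-involutive x c))
                (trans (cong (recolour x) (colour-unique P h h′)) (recolour-involutive x c′))
      }

    complete′ : ∀ {x y c} → M c x ≡ just y → M′ (recolour x c) x ≡ just y
    complete′ {x} {y} {c} h = subst (λ d → M d x ≡ just y) (sym (recolour-involutive x c)) h

    M′-outside : ∀ {x c} → K x ≡ false → M′ c x ≡ M c x
    M′-outside Kx rewrite Kx = refl

    M′-inside : ∀ {x c} → K x ≡ true → M′ c x ≡ M (swapColour c) x
    M′-inside Kx rewrite Kx = refl

  -- The α/β-alternating path from v starting with an α-edge: the Kempe chain
  -- whose colours are swapped when α is free at u and β is free at v.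
  module AlternatingPath {M : Matchings} (P : Proper M) (α β : Fin R) (u v : Fin n)
    (Mβv : M β v ≡ nothing) (Mαu : M α u ≡ nothing) (u≁v : side u ≢ side v) where

    odd : ℕ → Bool
    odd zero    = false
    odd (suc i) = not (odd i)

    γ : ℕ → Fin R
    γ i = if odd i then β else α

    γ-odd : ∀ {i j} → odd i ≡ odd j → γ i ≡ γ j
    γ-odd = cong (λ b → if b then β else α)

    path : ℕ → Maybe (Fin n)
    path zero    = just v
    path (suc i) = path i >>= M (γ i)

    path-suc⁻ : ∀ i {y} → path (suc i) ≡ just y → ∃ λ x → path i ≡ just x × M (γ i) x ≡ just y
    path-suc⁻ i h with path i
    ... | just x = x , refl , h

    path-suc : ∀ i {x} → path i ≡ just x → path (suc i) ≡ M (γ i) x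
    path-suc i h rewrite h = refl

    sideAt : ℕ → Bool
    sideAt i = if odd i then not (side v) else side v

    sideAt-suc : ∀ i → sideAt (suc i) ≡ not (sideAt i)
    sideAt-suc i with odd i
    ... | true  = sym (not-involutive (side v))
    ... | false = refl

    sideAt-even : ∀ i → odd i ≡ false → sideAt i ≡ side v
    sideAt-even i e rewrite e = refl

    path-side : ∀ i {x} → path i ≡ just x → side x ≡ sideAt i
    path-side zero    refl = refl
    path-side (suc i) h with path-suc⁻ i h
    ... | x , h₁ , h₂ = trans (¬-not (crossing P h₂ ∘ sym))
                              (trans (cong not (path-side i h₁)) (sym (sideAt-suc i)))

    odd-from-side : ∀ i j → sideAt i ≡ sideAt j → odd i ≡ odd j
    odd-from-side i j e with odd i | odd j
    ... | true  | true  = refl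
    ... | false | false = refl
    ... | true  | false = ⊥-elim (not-¬ refl (sym e))
    ... | false | true  = ⊥-elim (not-¬ refl e)

    odd-at-v : ∀ j → path (suc j) ≡ just v → odd j ≡ true
    odd-at-v j h = not-injective (sym (odd-from-side 0 (suc j) (path-side (suc j) h)))

    path-avoids-start : ∀ j → path (suc j) ≢ just v
    path-avoids-start j h with path-suc⁻ j h
    ... | x , _ , Mx≡v with () ← trans (sym Mβv)
            (subst (λ c → M c v ≡ just x) (γ-odd {j} {1} (odd-at-v j h)) (symmetric P Mx≡v))

    path-injective : ∀ i j {x} → path i ≡ just x → path j ≡ just x → i ≡ j
    path-injective zero    zero    _    _  = refl
    path-injective zero    (suc j) refl h′ = ⊥-elim (path-avoids-start j h′)
    path-injective (suc i) zero    h refl = ⊥-elim (path-avoids-start i h)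
    path-injective (suc i) (suc j) {x} h h′ with path-suc⁻ i h | path-suc⁻ j h′
    ... | x₁ , p₁ , m₁ | x₂ , p₂ , m₂ =
      cong suc (path-injective i j p₁ (subst (λ z → path j ≡ just z) (sym x₁≡x₂) p₂))
      where
      same-parity : odd i ≡ odd j
      same-parity = not-injective (odd-from-side (suc i) (suc j)
                      (trans (sym (path-side (suc i) h)) (path-side (suc j) h′)))
      x₁≡x₂ : x₁ ≡ x₂
      x₁≡x₂ = just-injective (trans (sym (symmetric P m₁))
                (subst (λ c → M c x ≡ just x₂) (sym (γ-odd {i} {j} same-parity)) (symmetric P m₂)))

    path-defined-before : ∀ i k {y} → path (k + i) ≡ just y → ∃ λ x → path i ≡ just x
    path-defined-before i zero    h = _ , h
    path-defined-before i (suc k) h = path-defined-before i k (proj₁ (proj₂ (path-suc⁻ (k + i) h)))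

    visited : ∀ i {y} → path i ≡ just y → (k : Fin (suc i)) → ∃ λ x → path (toℕ k) ≡ just x
    visited i {y} h k = path-defined-before (toℕ k) (i ∸ toℕ k)
      (subst (λ m → path m ≡ just y) (sym (ℕ.m∸n+n≡m (toℕ≤pred[n] k))) h)

    -- A path visits distinct vertices, so it has fewer than n steps.
    path-bound : ∀ i {y} → path i ≡ just y → i < n
    path-bound i h with i ℕ.<? n
    ... | yes i<n = i<n
    ... | no i≮n with pigeonhole (s≤s (ℕ.≮⇒≥ i≮n)) (proj₁ ∘ visited i h)
    ...   | k , l , k<l , same = ⊥-elim (ℕ.<⇒≢ k<l (path-injective (toℕ k) (toℕ l)
              (proj₂ (visited i h k))
              (subst (λ z → path (toℕ l) ≡ just z) (sym same) (proj₂ (visited i h l)))))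

    onPath : Fin n → Bool
    onPath x = does (any? (λ (i : Fin n) → Maybe.≡-dec _≟_ (path (toℕ i)) (just x)))

    onPath-intro : ∀ i {x} → path i ≡ just x → onPath x ≡ true
    onPath-intro i {x} h = dec-true (any? (λ (i : Fin n) → Maybe.≡-dec _≟_ (path (toℕ i)) (just x)))
      (fromℕ< (path-bound i h) , subst (λ m → path m ≡ just x) (sym (toℕ-fromℕ< (path-bound i h))) h)

    onPath-elim : ∀ {x} → onPath x ≡ true → ∃ λ i → path i ≡ just x
    onPath-elim {x} e with any? (λ (i : Fin n) → Maybe.≡-dec _≟_ (path (toℕ i)) (just x))
    onPath-elim refl | yes (i , h) = toℕ i , h

    other-colour : ∀ i {c} → (c ≡ α ⊎ c ≡ β) → c ≢ γ (suc i) → c ≡ γ i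
    other-colour i c∈ c≢ with odd i
    other-colour i (inj₁ c≡α) c≢ | true  = ⊥-elim (c≢ c≡α)
    other-colour i (inj₂ c≡β) c≢ | true  = c≡β
    other-colour i (inj₁ c≡α) c≢ | false = c≡α
    other-colour i (inj₂ c≡β) c≢ | false = ⊥-elim (c≢ c≡β)

    closed : ∀ {c x y} → onPath x ≡ true → (c ≡ α ⊎ c ≡ β) → M c x ≡ just y → onPath y ≡ true
    closed {c} {x} {y} onX c∈ h with onPath-elim onX
    ... | i , px with c ≟ γ i
    ...   | yes refl = onPath-intro (suc i) (trans (path-suc i px) h)
    closed {c} {x} {y} onX c∈ h | zero , refl | no c≢α with c∈
    ...   | inj₁ c≡α = ⊥-elim (c≢α c≡α)
    ...   | inj₂ refl with () ← trans (sym Mβv) h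
    closed {c} {x} {y} onX c∈ h | suc i , px | no c≢ with path-suc⁻ i px
    ...   | x′ , p′ , m′ =
      onPath-intro i (subst (λ z → path i ≡ just z) (just-injective (trans (sym back) h)) p′)
      where
      back : M c x ≡ just x′
      back = subst (λ d → M d x ≡ just x′) (sym (other-colour i c∈ c≢)) (symmetric P m′)

    v-onPath : onPath v ≡ true
    v-onPath = onPath-intro 0 refl

    -- Vertices at odd steps lie on u's side, and are entered along α-edges.
    odd-at-u : ∀ j → path (suc j) ≡ just u → odd j ≡ false
    odd-at-u j h = ¬-not (λ e → u≁v (trans (path-side (suc j) h) (sideAt-even (suc j) (cong not e))))

    u-unreachable : ∀ j → path (suc j) ≢ just u
    u-unreachable j h = entered (path-suc⁻ j h) (γ-odd {j} {0} (odd-at-u j h))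
      where
      entered : (∃ λ x → path j ≡ just x × M (γ j) x ≡ just u) → γ j ≡ α → ⊥
      entered (x , _ , Mx≡u) γj≡α with () ← trans (sym Mαu)
        (subst (λ c → M c u ≡ just x) γj≡α (symmetric P Mx≡u))

    u-offPath : onPath u ≡ false
    u-offPath with onPath u in onU
    ... | false = refl
    ... | true with onPath-elim onU
    ...   | zero  , refl = ⊥-elim (u≁v refl)
    ...   | suc j , h    = ⊥-elim (u-unreachable j h)

  module AddEdge {M : Matchings} (P : Proper M) (α : Fin R) (u v : Fin n)
    (Mαu : M α u ≡ nothing) (Mαv : M α v ≡ nothing) (u≁v : side u ≢ side v)
    (uv-uncoloured : ∀ {c} → M c u ≢ just v) where

    M⁺ : Matchings
    M⁺ c x with c ≟ α
    ... | no _ = M c x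
    ... | yes _ with x ≟ u
    ...   | yes _ = just v
    ...   | no _ with x ≟ v
    ...     | yes _ = just u
    ...     | no _  = M c x

    data Cases (c : Fin R) (x y : Fin n) : Set where
      new-uv : c ≡ α → x ≡ u → y ≡ v → Cases c x y
      new-vu : c ≡ α → x ≡ v → y ≡ u → Cases c x y
      old    : M c x ≡ just y → Cases c x y

    cases : ∀ {c x y} → M⁺ c x ≡ just y → Cases c x y
    cases {c} {x} h with c ≟ α
    ... | no _ = old h
    ... | yes c≡α with x ≟ u
    ...   | yes x≡u = new-uv c≡α x≡u (sym (just-injective h))
    ...   | no _ with x ≟ v
    ...     | yes x≡v = new-vu c≡α x≡v (sym (just-injective h))
    ...     | no _    = old h

    M⁺-extends : ∀ {c x y} → M c x ≡ just y → M⁺ c x ≡ just y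
    M⁺-extends {c} {x} h with c ≟ α
    ... | no _ = h
    ... | yes refl with x ≟ u
    ...   | yes refl with () ← trans (sym Mαu) h
    ...   | no _ with x ≟ v
    ...     | yes refl with () ← trans (sym Mαv) h
    ...     | no _ = h

    M⁺-uv : M⁺ α u ≡ just v
    M⁺-uv with α ≟ α
    ... | no α≢α = ⊥-elim (α≢α refl)
    ... | yes _ with u ≟ u
    ...   | yes _   = refl
    ...   | no u≢u = ⊥-elim (u≢u refl)

    M⁺-vu : M⁺ α v ≡ just u
    M⁺-vu with α ≟ α
    ... | no α≢α = ⊥-elim (α≢α refl)
    ... | yes _ with v ≟ u
    ...   | yes refl = ⊥-elim (u≁v refl)
    ...   | no _ with v ≟ v
    ...     | yes _   = refl
    ...     | no v≢v = ⊥-elim (v≢v refl)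

    symmetric⁺ : ∀ {c x y} → M⁺ c x ≡ just y → M⁺ c y ≡ just x
    symmetric⁺ {c} {x} {y} h with cases {c} {x} {y} h
    ... | new-uv refl refl refl = M⁺-vu
    ... | new-vu refl refl refl = M⁺-uv
    ... | old h′ = M⁺-extends (symmetric P h′)

    crossing⁺ : ∀ {c x y} → M⁺ c x ≡ just y → side x ≢ side y
    crossing⁺ {c} {x} {y} h with cases {c} {x} {y} h
    ... | new-uv _ refl refl = u≁v
    ... | new-vu _ refl refl = u≁v ∘ sym
    ... | old h′ = crossing P h′

    colour-unique⁺ : ∀ {c c′ x y} → M⁺ c x ≡ just y → M⁺ c′ x ≡ just y → c ≡ c′
    colour-unique⁺ {c} {c′} {x} {y} h h′ with cases {c} {x} {y} h | cases {c′} {x} {y} h′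
    ... | new-uv refl _ _       | new-uv refl _ _    = refl
    ... | new-uv refl _ _       | new-vu refl _ _    = refl
    ... | new-vu refl _ _       | new-uv refl _ _    = refl
    ... | new-vu refl _ _       | new-vu refl _ _    = refl
    ... | new-uv _ refl refl    | old h″             = ⊥-elim (uv-uncoloured h″)
    ... | new-vu _ refl refl    | old h″             = ⊥-elim (uv-uncoloured (symmetric P h″))
    ... | old h″                | new-uv _ refl refl = ⊥-elim (uv-uncoloured h″)
    ... | old h″                | new-vu _ refl refl = ⊥-elim (uv-uncoloured (symmetric P h″))
    ... | old h″                | old h‴             = colour-unique P h″ h‴

    proper⁺ : Proper M⁺
    proper⁺ = record
      { symmetric     = λ {c} {x} {y} → symmetric⁺ {c} {x} {y}
      ; crossing      = λ {c} {x} {y} → crossing⁺ {c} {x} {y}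
      ; colour-unique = λ {c} {c′} {x} {y} → colour-unique⁺ {c} {c′} {x} {y}
      }

    sound⁺ : ∀ {es} → Sound M es → Sound M⁺ ((u , v) ∷ es)
    sound⁺ S {c} {x} {y} h with cases {c} {x} {y} h
    ... | new-uv _ refl refl = inj₁ (here refl)
    ... | new-vu _ refl refl = inj₂ (here refl)
    ... | old h′ with S h′
    ...   | inj₁ e∈ = inj₁ (there e∈)
    ...   | inj₂ e∈ = inj₂ (there e∈)

    complete⁺ : ∀ {es} → Complete M es → Complete M⁺ ((u , v) ∷ es)
    complete⁺ C (here refl) = α , M⁺-uv
    complete⁺ C (there e∈) with C e∈
    ... | c , h = c , M⁺-extends {c} h

  module _ {M : Matchings} {es : List (Edge n)} (P : Proper M) (S : Sound M es) (x : Fin n) where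

    private
      incidentEdges : List (Edge n)
      incidentEdges = filter (incident? x) es

    usedEdge : ∀ {c y} → M c x ≡ just y → ∃ λ e → e ∈ incidentEdges × Joins e x y
    usedEdge h with S h
    ... | inj₁ e∈ = _ , ∈-filter⁺ (incident? x) e∈ (inj₁ refl) , inj₁ refl
    ... | inj₂ e∈ = _ , ∈-filter⁺ (incident? x) e∈ (inj₂ refl) , inj₂ refl

    usedEdgeIndex : ∀ {c y} → M c x ≡ just y → Fin (degreeIn es x)
    usedEdgeIndex h = index (proj₁ (proj₂ (usedEdge h)))

    usedEdgeIndex-injective : ∀ {c c′ y y′} (h : M c x ≡ just y) (h′ : M c′ x ≡ just y′) →
                              usedEdgeIndex h ≡ usedEdgeIndex h′ → c ≡ c′
    usedEdgeIndex-injective {c} {c′} {y} {y′} h h′ same =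
      colour-unique P h (subst (λ z → M c′ x ≡ just z) (sym y≡y′) h′)
      where
      e≡e′ : proj₁ (usedEdge h) ≡ proj₁ (usedEdge h′)
      e≡e′ = trans (Any.lookup-index (proj₁ (proj₂ (usedEdge h))))
               (trans (cong (lookup incidentEdges) same) (sym (Any.lookup-index (proj₁ (proj₂ (usedEdge h′))))))
      y≡y′ : y ≡ y′
      y≡y′ = Joins-injectiveʳ (crossing P h ∘ cong side) (proj₂ (proj₂ (usedEdge h)))
               (subst (λ e → Joins e x y′) (sym e≡e′) (proj₂ (proj₂ (usedEdge h′))))

    partnerOf : ¬ (∃ λ c → M c x ≡ nothing) → ∀ c → ∃ λ y → M c x ≡ just y
    partnerOf ¬free c with M c x in h
    ... | nothing = ⊥-elim (¬free (c , h))
    ... | just y  = y , refl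

    freeColour : degreeIn es x < R → ∃ λ c → M c x ≡ nothing
    freeColour deg<R with any? (λ c → Maybe.≡-dec _≟_ (M c x) nothing)
    ... | yes free  = free
    ... | no ¬free with pigeonhole deg<R (λ c → usedEdgeIndex (proj₂ (partnerOf ¬free c)))
    ...   | c , c′ , c<c′ , same = ⊥-elim (ℕ.<⇒≢ c<c′ (cong toℕ (usedEdgeIndex-injective _ _ same)))

  module _ {M : Matchings} {es : List (Edge n)} (P : Proper M) (C : Complete M es)
           (canonical : All Canonical es) (unique : Unique es) (x : Fin n) where

    private
      incidentEdges : List (Edge n)
      incidentEdges = filter (incident? x) es

    record ColourOf (e : Edge n) : Set where
      constructor coloured
      field
        colour  : Fin R
        partner : Fin n
        matched : M colour x ≡ just partner
        joins   : Joins e x partner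
    open ColourOf

    incidentColour : ∀ {e} → e ∈ es → (proj₁ e ≡ x ⊎ proj₂ e ≡ x) → ColourOf e
    incidentColour {a , b} e∈ (inj₁ refl) = coloured (proj₁ (C e∈)) b (proj₂ (C e∈)) (inj₁ refl)
    incidentColour {a , b} e∈ (inj₂ refl) = coloured (proj₁ (C e∈)) a (symmetric P (proj₂ (C e∈))) (inj₂ refl)

    colourAt : (p : Fin (degreeIn es x)) → ColourOf (lookup incidentEdges p)
    colourAt p = uncurry incidentColour (∈-filter⁻ (incident? x) {xs = es} (∈-lookup p))

    canonicalAt : (p : Fin (degreeIn es x)) → Canonical (lookup incidentEdges p)
    canonicalAt p = All.lookup canonical (proj₁ (∈-filter⁻ (incident? x) {xs = es} (∈-lookup p)))

    colourAt-injective : ∀ {p q} → colour (colourAt p) ≡ colour (colourAt q) → p ≡ q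
    colourAt-injective {p} {q} same =
      Unique-lookup-injective (Unique.filter⁺ (incident? x) unique)
        (Joins-canonical (canonicalAt p) (canonicalAt q) (joins (colourAt p))
          (subst (Joins (lookup incidentEdges q) x) (sym same-partner) (joins (colourAt q))))
      where
      same-partner : partner (colourAt p) ≡ partner (colourAt q)
      same-partner = just-injective (trans (sym (matched (colourAt p)))
        (subst (λ d → M d x ≡ just (partner (colourAt q))) (sym same) (matched (colourAt q))))

    -- A colour c free at x would be a (degree + 1)-th colour at x.
    colourWithFree : Fin R → Fin (suc (degreeIn es x)) → Fin R
    colourWithFree c fz     = c
    colourWithFree c (fs p) = colour (colourAt p)

    saturated : degreeIn es x ≡ R → ∀ c → ∃ λ y → M c x ≡ just y
    saturated deg≡R c with M c x in free
    ... | just y  = y , refl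
    ... | nothing with pigeonhole (ℕ.≤-reflexive (cong suc (sym deg≡R))) (colourWithFree c)
    ...   | fz   , fz   , ()      , _
    ...   | fs _ , fz   , ()      , _
    ...   | fz   , fs p , _       , same with () ← trans (sym free)
            (subst (λ d → M d x ≡ just (partner (colourAt p))) (sym same) (matched (colourAt p)))
    ...   | fs p , fs q , s≤s p<q , same = ⊥-elim (ℕ.<⇒≢ p<q (cong toℕ (colourAt-injective same)))

  open Colouring

  commonFreeColour : ∀ {es u v} (χ : Colouring es) → side u ≢ side v →
                     degreeIn es u < R → degreeIn es v < R →
                     Σ (Colouring es) λ χ′ → ∃ λ α → M χ′ α u ≡ nothing × M χ′ α v ≡ nothing
  commonFreeColour {es} {u} {v} χ u≁v deg-u deg-v
    with freeColour (proper χ) (sound χ) u deg-u | freeColour (proper χ) (sound χ) v deg-v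
  ... | α , Mαu | β , Mβv with M χ α v in Mαv
  ...   | nothing = χ , α , Mαu , Mαv
  ...   | just _  = record { M = M′ ; proper = proper′ ; sound = sound χ ; complete = complete-swapped }
                  , α , trans (M′-outside u-offPath) Mαu
                  , trans (M′-inside v-onPath) (trans (cong (λ d → M χ d v) swapColour-α) Mβv)
    where
    open AlternatingPath (proper χ) α β u v Mβv Mαu u≁v
    open KempeSwap (proper χ) α β onPath closed
    complete-swapped : Complete M′ es
    complete-swapped {x} e∈ = recolour x (proj₁ (complete χ e∈)) , complete′ (proj₂ (complete χ e∈))

  new-edge-uncoloured : ∀ {u v es} → All Canonical ((u , v) ∷ es) → Unique ((u , v) ∷ es) →
                       ¬ Adjacent es u v
  new-edge-uncoloured (_    ∷ _)   (uv∉ ∷ _) (inj₁ uv∈) = All.lookup uv∉ uv∈ refl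
  new-edge-uncoloured (u<v ∷ can) _         (inj₂ vu∈) = ℕ.<-asym u<v (All.lookup can vu∈)

  addEdge : ∀ {es u v} → All Canonical ((u , v) ∷ es) → Unique ((u , v) ∷ es) → side u ≢ side v →
            degreeIn es u < R → degreeIn es v < R → Colouring es → Colouring ((u , v) ∷ es)
  addEdge {es} {u} {v} can uniq u≁v deg-u deg-v χ with commonFreeColour χ u≁v deg-u deg-v
  ... | χ′ , α , Mαu , Mαv = record
    { M        = M⁺
    ; proper   = proper⁺
    ; sound    = λ {c} {x} {y} → sound⁺ (sound χ′) {c} {x} {y}
    ; complete = complete⁺ (complete χ′)
    }
    where open AddEdge (proper χ′) α u v Mαu Mαv u≁v (new-edge-uncoloured can uniq ∘ sound χ′)

  edgeColouring : (es : List (Edge n)) → All Canonical es → Unique es →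
                  All (λ e → side (proj₁ e) ≢ side (proj₂ e)) es → (∀ x → degreeIn es x ≤ R) →
                  Colouring es
  edgeColouring [] _ _ _ _ = record
    { M = λ _ _ → nothing
    ; proper = record { symmetric = λ () ; crossing = λ () ; colour-unique = λ () }
    ; sound = λ ()
    ; complete = λ ()
    }
  edgeColouring ((u , v) ∷ es) (u<v ∷ can) (uv∉ ∷ uniq) (u≁v ∷ crosses) deg≤R =
    addEdge (u<v ∷ can) (uv∉ ∷ uniq) u≁v
      (subst (_≤ R) (degreeIn-∷-incident (u , v) es u (inj₁ refl)) (deg≤R u))
      (subst (_≤ R) (degreeIn-∷-incident (u , v) es v (inj₂ refl)) (deg≤R v))
      (edgeColouring es can uniq crosses (λ x → ℕ.≤-trans (degreeIn-∷-≤ (u , v) es x) (deg≤R x)))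

record OneFactorisation {n : ℕ} (E : List (Edge n)) (R : ℕ) : Set where
  field
    partner            : Fin R → Fin n → Fin n
    partner-involutive : ∀ c x → partner c (partner c x) ≡ x
    partner-injectiveˡ : ∀ {c c′ x} → partner c x ≡ partner c′ x → c ≡ c′
    partner-adjacent   : ∀ c x → (x , partner c x) ∈ E ⊎ (partner c x , x) ∈ E
    partner-onto       : ∀ {x y} → (x , y) ∈ E → ∃ λ c → partner c x ≡ y

-- In a regular graph every colour of a König colouring is a perfect matching.
oneFactorisation : ∀ {n R} (G : SimpleGraph n) → Bipartite G → Regular R G → OneFactorisation (edges G) R
oneFactorisation {n} {R} G (side , crosses) regular = record
  { partner            = partner
  ; partner-involutive = λ c x → just-injective (trans (sym (matched c (partner c x)))
                                   (symmetric proper (matched c x)))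
  ; partner-injectiveˡ = λ {c} {c′} {x} same →
      colour-unique proper (matched c x) (subst (λ y → M c′ x ≡ just y) (sym same) (matched c′ x))
  ; partner-adjacent   = λ c x → sound (matched c x)
  ; partner-onto       = λ {x} {y} e∈ → proj₁ (complete e∈)
      , just-injective (trans (sym (matched (proj₁ (complete e∈)) x)) (proj₂ (complete e∈)))
  }
  where
  open EdgeColouring side R
  open Colouring (edgeColouring (edges G) (canonical G) (simple G) crosses (ℕ.≤-reflexive ∘ regular))
  open Proper
  saturated-at : ∀ c x → ∃ λ y → M c x ≡ just y
  saturated-at c x = saturated proper complete (canonical G) (simple G) x (regular x) c
  partner : Fin R → Fin n → Fin n
  partner c x = proj₁ (saturated-at c x)
  matched : ∀ c x → M c x ≡ just (partner c x)
  matched c x = proj₂ (saturated-at c x)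

-- Cutting a one-factorisation into double stars

module Decomposition {n : ℕ} {E : List (Edge n)} (canonicalE : All Canonical E) (uniqueE : Unique E)
  (side : Fin n → Bool) (crossesE : All (λ e → side (proj₁ e) ≢ side (proj₂ e)) E)
  (t k₁ k₂ : ℕ) (F : OneFactorisation E (t * suc (k₁ + k₂))) where

  open OneFactorisation F
  open DoubleStar k₁ k₂

  K : ℕ
  K = k₁ + k₂

  centreColour : Fin t → Fin (t * suc K)
  centreColour j = combine j fz

  leafColour : Fin t → Fin K → Fin (t * suc K)
  leafColour j z = combine j (fs z)

  leafColour≢centreColour : ∀ j z → leafColour j z ≢ centreColour j
  leafColour≢centreColour j z e with () ← proj₂ (combine-injective j (fs z) j fz e)

  leafColour-injective : ∀ j {z z′} → leafColour j z ≡ leafColour j z′ → z ≡ z′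
  leafColour-injective j e = suc-injective (proj₂ (combine-injective j _ j _ e))

  partner-side : ∀ c x → side (partner c x) ≡ not (side x)
  partner-side c x with partner-adjacent c x
  ... | inj₁ e∈ = ¬-not (All.lookup crossesE e∈ ∘ sym)
  ... | inj₂ e∈ = ¬-not (All.lookup crossesE e∈)

  side-partner : ∀ c {x y} → y ≡ partner c x → side y ≡ not (side x)
  side-partner c refl = partner-side c _

  partner-crossing : ∀ c x → side x ≢ side (partner c x)
  partner-crossing c x e = not-¬ refl (trans e (partner-side c x))

  second : Fin t → Fin n → Fin n
  second j a = partner (centreColour j) a

  leaf : Fin t → Fin n → Fin K → Fin n
  leaf j a z =
    [ const (partner (leafColour j z) a) , const (partner (leafColour j z) (second j a)) ]′ (splitAt k₁ z)

  leaf-left : ∀ j a i → leaf j a (i ↑ˡ k₂) ≡ partner (leafColour j (i ↑ˡ k₂)) a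
  leaf-left j a i rewrite splitAt-↑ˡ k₁ i k₂ = refl

  leaf-right : ∀ j a i → leaf j a (k₁ ↑ʳ i) ≡ partner (leafColour j (k₁ ↑ʳ i)) (second j a)
  leaf-right j a i rewrite splitAt-↑ʳ k₁ k₂ i = refl

  leaf-cases : ∀ j a z → leaf j a z ≡ partner (leafColour j z) a
                       ⊎ leaf j a z ≡ partner (leafColour j z) (second j a)
  leaf-cases j a z with splitAt k₁ z
  ... | inj₁ _ = inj₁ refl
  ... | inj₂ _ = inj₂ refl

  star : Fin t → Fin n → Fin V → Fin n
  star j a fz          = a
  star j a (fs fz)     = second j a
  star j a (fs (fs z)) = leaf j a z

  first≢leaf : ∀ j a z → a ≢ leaf j a z
  first≢leaf j a z e with leaf-cases j a z
  ... | inj₁ q = partner-crossing (leafColour j z) a (cong side (trans e q))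
  ... | inj₂ q = leafColour≢centreColour j z (partner-injectiveˡ
                   (trans (cong (partner (leafColour j z)) (trans e q)) (partner-involutive _ (second j a))))

  second≢leaf : ∀ j a z → second j a ≢ leaf j a z
  second≢leaf j a z e with leaf-cases j a z
  ... | inj₁ q = leafColour≢centreColour j z (partner-injectiveˡ (sym (trans e q)))
  ... | inj₂ q = partner-crossing (leafColour j z) (second j a) (cong side (trans e q))

  -- Leaves of the two centres lie on opposite sides, so only leaves of one centre can collide.
  leaf-injective : ∀ j a {z z′} → leaf j a z ≡ leaf j a z′ → z ≡ z′
  leaf-injective j a {z} {z′} e with leaf-cases j a z | leaf-cases j a z′
  ... | inj₁ q | inj₁ q′ = leafColour-injective j (partner-injectiveˡ (trans (sym q) (trans e q′)))
  ... | inj₂ q | inj₂ q′ = leafColour-injective j (partner-injectiveˡ (trans (sym q) (trans e q′)))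
  ... | inj₁ q | inj₂ q′ = ⊥-elim (not-¬ refl (trans (sym (side-partner _ q))
        (trans (cong side e) (trans (side-partner _ q′) (cong not (partner-side _ a))))))
  ... | inj₂ q | inj₁ q′ = ⊥-elim (not-¬ refl (trans (sym (side-partner _ q′))
        (trans (cong side (sym e)) (trans (side-partner _ q) (cong not (partner-side _ a))))))

  star-injective : ∀ j a → Injective _≡_ _≡_ (star j a)
  star-injective j a {fz}        {fz}         e = refl
  star-injective j a {fz}        {fs fz}      e = ⊥-elim (partner-crossing (centreColour j) a (cong side e))
  star-injective j a {fs fz}     {fz}         e = ⊥-elim (partner-crossing (centreColour j) a (cong side (sym e)))
  star-injective j a {fz}        {fs (fs z)}  e = ⊥-elim (first≢leaf j a z e)
  star-injective j a {fs (fs z)} {fz}         e = ⊥-elim (first≢leaf j a z (sym e))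
  star-injective j a {fs fz}     {fs fz}      e = refl
  star-injective j a {fs fz}     {fs (fs z)}  e = ⊥-elim (second≢leaf j a z e)
  star-injective j a {fs (fs z)} {fs fz}      e = ⊥-elim (second≢leaf j a z (sym e))
  star-injective j a {fs (fs z)} {fs (fs z′)} e = cong (fs ∘ fs) (leaf-injective j a e)

  part : Fin t × Fin n → Embedding k₁ k₂ n
  part (j , a) = record { f = star j a ; inj = star-injective j a }

  centres : List (Fin t × Fin n)
  centres = cartesianProduct (allFin t) (filter (λ a → side a ≟ᵇ true) (allFin n))

  centre∈ : ∀ j {a} → side a ≡ true → (j , a) ∈ centres
  centre∈ j {a} a-true =
    ∈-cartesianProduct⁺ (∈-allFin j) (∈-filter⁺ (λ a → side a ≟ᵇ true) (∈-allFin a) a-true)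

  centre-side : ∀ {q} → q ∈ centres → side (proj₂ q) ≡ true
  centre-side q∈ = proj₂ (∈-filter⁻ (λ a → side a ≟ᵇ true) {xs = allFin n}
                     (proj₂ (∈-cartesianProduct⁻ (allFin t) _ q∈)))

  L : List (Edge n)
  L = concatMap copyEdges (map part centres)

  starEdge : Fin t → Fin n → Edge V → Edge n
  starEdge j a (x , y) = norm (star j a x , star j a y)

  starEdge∈L : ∀ j {a} → side a ≡ true → ∀ {s} → s ∈ doubleStarEdges k₁ k₂ → starEdge j a s ∈ L
  starEdge∈L j a-true s∈ = ∈-concatMap⁺ copyEdges
    (Any.map⁺ (Any.map (λ { refl → ∈-map⁺ (starEdge j _) s∈ }) (centre∈ j a-true)))

  starEdge-matched : ∀ j a {s} → s ∈ doubleStarEdges k₁ k₂ →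
                     ∃ λ c → partner c (star j a (proj₁ s)) ≡ star j a (proj₂ s)
  starEdge-matched j a s∈ with shape s∈
  ... | centre  = centreColour j , refl
  ... | left i  = leafColour j (i ↑ˡ k₂) , sym (leaf-left j a i)
  ... | right i = leafColour j (k₁ ↑ʳ i) , sym (leaf-right j a i)

  norm∈E : ∀ c x → norm (x , partner c x) ∈ E
  norm∈E c x with partner-adjacent c x
  ... | inj₁ e∈ = subst (_∈ E) (sym (norm-canonical (All.lookup canonicalE e∈))) e∈
  ... | inj₂ e∈ = subst (_∈ E) (trans (sym (norm-canonical (All.lookup canonicalE e∈))) (norm-comm _ x)) e∈

  L⊆E : ∀ {e} → e ∈ L → e ∈ E
  L⊆E e∈ with find (∈-concatMap⁻ copyEdges {xs = map part centres} e∈)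
  ... | φ , φ∈ , e∈φ with ∈-map⁻ part φ∈
  ...   | (j , a) , _ , refl with ∈-map⁻ (starEdge j a) e∈φ
  ...     | s , s∈ , refl with starEdge-matched j a s∈
  ...       | c , matched = subst (λ y → norm (star j a (proj₁ s) , y) ∈ E) matched (norm∈E c _)

  blockEdge∈L : ∀ {a b} (j : Fin t) (i : Fin (suc K)) → side a ≡ true → partner (combine j i) a ≡ b →
           norm (a , b) ∈ L
  blockEdge∈L {a} j fz a-true refl = starEdge∈L j a-true (here refl)
  blockEdge∈L {a} j (fs z) a-true refl with splitAt k₁ z in split
  ... | inj₁ i with refl ← splitAt⁻¹-↑ˡ split =
    subst (λ y → norm (a , y) ∈ L) (leaf-left j a i) (starEdge∈L j a-true (leftEdge∈ i))
  ... | inj₂ i with refl ← splitAt⁻¹-↑ʳ split =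
    subst (_∈ L) (trans (cong₂ (λ x y → norm (x , y)) b′≡b a′≡a) (norm-comm _ a))
      (starEdge∈L j a′-true (rightEdge∈ i))
    where
    b : Fin n
    b = partner (combine j (fs (k₁ ↑ʳ i))) a
    a′ : Fin n
    a′ = second j b
    a′-true : side a′ ≡ true
    a′-true = trans (partner-side _ b) (trans (cong not (partner-side _ a)) (trans (not-involutive _) a-true))
    b′≡b : second j a′ ≡ b
    b′≡b = partner-involutive _ b
    a′≡a : leaf j a′ (k₁ ↑ʳ i) ≡ a
    a′≡a = trans (leaf-right j a′ i) (trans (cong (partner _) b′≡b) (partner-involutive _ a))

  matchedEdge∈L : ∀ c {a b} → side a ≡ true → partner c a ≡ b → norm (a , b) ∈ L
  matchedEdge∈L c a-true matched with remQuot {t} (suc K) c in split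
  ... | j , i = blockEdge∈L j i a-true (trans (cong (λ d → partner d _)
                  (trans (cong (uncurry combine) (sym split)) (combine-remQuot {t} (suc K) c))) matched)

  E⊆L : ∀ {e} → e ∈ E → e ∈ L
  E⊆L {x , y} e∈ with partner-onto e∈ | side x in x-side
  ... | c , matched | true  =
    subst (_∈ L) (norm-canonical (All.lookup canonicalE e∈)) (matchedEdge∈L c x-side matched)
  ... | c , matched | false =
    subst (_∈ L) (trans (norm-comm y x) (norm-canonical (All.lookup canonicalE e∈)))
      (matchedEdge∈L c y-true (trans (cong (partner c) (sym matched)) (partner-involutive c x)))
    where
    y-true : side y ≡ true
    y-true = trans (side-partner c (sym matched)) (cong not x-side)

  colourOf : Fin n → Fin n → Maybe (Fin (t * suc K))
  colourOf a b with any? (λ c → partner c a ≟ b)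
  ... | yes (c , _) = just c
  ... | no _        = nothing

  colourOf-partner : ∀ {c a b} → partner c a ≡ b → colourOf a b ≡ just c
  colourOf-partner {c} {a} {b} matched with any? (λ c → partner c a ≟ b)
  ... | yes (c′ , matched′) = cong just (partner-injectiveˡ (trans matched′ (sym matched)))
  ... | no ¬matched         = ⊥-elim (¬matched (c , matched))

  ownerCentre : Fin t → Fin n → Fin n → Fin (suc K) → Fin n
  ownerCentre j a b fz     = a
  ownerCentre j a b (fs z) = [ const a , const (second j b) ]′ (splitAt k₁ z)

  ownerOfColour : Fin n → Fin n → Fin t × Fin (suc K) → Fin t × Fin n
  ownerOfColour a b (j , i) = j , ownerCentre j a b i

  -- The star holding the edge a–b, where a is on the true side.
  ownerOf : Fin n → Fin n → Maybe (Fin t × Fin n)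
  ownerOf a b with colourOf a b
  ... | nothing = nothing
  ... | just c  = just (ownerOfColour a b (remQuot (suc K) c))

  ownerOf-colour : ∀ j i {a b} → partner (combine j i) a ≡ b → ownerOf a b ≡ just (j , ownerCentre j a b i)
  ownerOf-colour j i {a} {b} matched rewrite colourOf-partner matched =
    cong (just ∘ ownerOfColour a b) (remQuot-combine {t} {suc K} j i)

  owner : Edge n → Maybe (Fin t × Fin n)
  owner (x , y) = if side x then ownerOf x y else ownerOf y x

  owner-norm : ∀ {a b} → side a ≡ true → side b ≡ false → owner (norm (a , b)) ≡ ownerOf a b
  owner-norm {a} {b} a-true b-false with norm-cases a b
  ... | inj₁ e rewrite e | a-true  = refl
  ... | inj₂ e rewrite e | b-false = refl

  owner-part : ∀ j a → side a ≡ true → All (λ e → owner e ≡ just (j , a)) (copyEdges (part (j , a)))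
  owner-part j a a-true = All.map⁺ (All.tabulate owned)
    where
    b : Fin n
    b = second j a
    b-false : side b ≡ false
    b-false = trans (partner-side _ a) (cong not a-true)
    owned : ∀ {s} → s ∈ doubleStarEdges k₁ k₂ → owner (starEdge j a s) ≡ just (j , a)
    owned s∈ with shape s∈
    ... | centre  = trans (owner-norm a-true b-false) (ownerOf-colour j fz refl)
    ... | left i  = begin
      owner (norm (a , leaf j a (i ↑ˡ k₂)))  ≡⟨ cong (λ z → owner (norm (a , z))) (leaf-left j a i) ⟩
      owner (norm (a , y))                   ≡⟨ owner-norm a-true (trans (partner-side _ a) (cong not a-true)) ⟩
      ownerOf a y                            ≡⟨ ownerOf-colour j (fs (i ↑ˡ k₂)) refl ⟩
      just (j , ownerCentre j a y (fs (i ↑ˡ k₂)))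
        ≡⟨ cong (λ z → just (j , [ const a , const (second j y) ]′ z)) (splitAt-↑ˡ k₁ i k₂) ⟩
      just (j , a)                           ∎
      where
      y : Fin n
      y = partner (leafColour j (i ↑ˡ k₂)) a
    ... | right i = begin
      owner (norm (b , leaf j a (k₁ ↑ʳ i)))  ≡⟨ cong (λ z → owner (norm (b , z))) (leaf-right j a i) ⟩
      owner (norm (b , y))                   ≡⟨ cong owner (norm-comm b y) ⟩
      owner (norm (y , b))                   ≡⟨ owner-norm y-true b-false ⟩
      ownerOf y b                            ≡⟨ ownerOf-colour j (fs (k₁ ↑ʳ i)) (partner-involutive _ b) ⟩
      just (j , ownerCentre j y b (fs (k₁ ↑ʳ i)))
        ≡⟨ cong (λ z → just (j , [ const y , const (second j b) ]′ z)) (splitAt-↑ʳ k₁ k₂ i) ⟩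
      just (j , second j b)                  ≡⟨ cong (λ z → just (j , z)) (partner-involutive _ a) ⟩
      just (j , a)                           ∎
      where
      y : Fin n
      y = partner (leafColour j (k₁ ↑ʳ i)) b
      y-true : side y ≡ true
      y-true = trans (partner-side _ b) (cong not b-false)

  L-unique : Unique L
  L-unique = subst Unique (sym (concatMap-map copyEdges part centres))
    (Unique-concatMap⁺ owner (copyEdges ∘ part) centres
      (Unique.cartesianProduct⁺ (Unique.allFin⁺ t)
                                (Unique.filter⁺ (λ a → side a ≟ᵇ true) (Unique.allFin⁺ n)))
      (copyEdges-unique ∘ part)
      (λ { {j , a} q∈ → owner-part j a (centre-side q∈) }))

  L↭E : L ↭ E
  L↭E = ∼bag⇒↭ (unique∧set⇒bag L-unique uniqueE (mk⇔ L⊆E E⊆L))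

mainTheorem1 : (r s : ℕ) → 3 ≤ r → 3 ≤ s → s ∣ r →
    (n : ℕ) (G : SimpleGraph n) → Bipartite G → Regular r G →
    (k₁ k₂ : ℕ) → 1 ≤ k₁ → 1 ≤ k₂ → k₁ + k₂ + 1 ≡ s →
    DoubleStarDecomposable k₁ k₂ G
mainTheorem1 r s _ _ (divides t r≡ts) n G bipartite@(side , crosses) regular k₁ k₂ _ _ refl =
  map part centres , L↭E
  where
  r≡R : r ≡ t * suc (k₁ + k₂)
  r≡R = trans r≡ts (cong (t *_) (ℕ.+-comm (k₁ + k₂) 1))
  open Decomposition (canonical G) (simple G) side crosses t k₁ k₂
         (oneFactorisation G bipartite (λ x → trans (regular x) r≡R))
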